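{- If $G$ is a double path, then $Z(G)=2$.
   Context: All graphs are finite and simple. A graph is outerplanar if it has a planar embedding in which all vertices lie on a single face. A double path is an outerplanar graph, which is not a path, whose vertex set can be covered by two vertex-disjoint induced paths. Zero forcing: colour each vertex black or white; if a black vertex $u$ has exactly one white neighbour $v$, then $u$ may force $v$ to become black. A set of initially black vertices is a zero forcing set if repeated application of this rule makes all vertices black; $Z(G)$ is the minimum size of a zero forcing set. -}

module Defs where

open import Data.Nat using (ℕ; zero; suc; _<_; _≤_)
open import Data.Fin using (Fin; toℕ)
open import Data.Fin.Subset using (Subset; _∈_; ∣_∣)
open import Data.List using (List; length; lookup; _++_)
open import Data.List.Membership.Propositional renaming (_∈_ to _∈ₗ_)
open import Data.List.Relation.Unary.Unique.Propositional using (Unique)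
open import Data.Product using (Σ; ∃; _×_; _,_)
open import Data.Sum using (_⊎_)
open import Function.Definitions using (Injective)
open import Function.Bundles using (_⇔_)
open import Relation.Binary.PropositionalEquality using (_≡_; _≢_)
open import Relation.Nullary using (¬_)

record Graph (n : ℕ) : Set₁ where
  field
    E     : Fin n → Fin n → Set
    sym   : ∀ {u v} → E u v → E v u
    irrefl : ∀ {u} → ¬ E u u
open Graph public

module _ {n : ℕ} (G : Graph n) where

  IsInducedPath : List (Fin n) → Set
  IsInducedPath P =
    Unique P ×
    (∀ (i j : Fin (length P)) →
      E G (lookup P i) (lookup P j) ⇔ (toℕ i ≡ suc (toℕ j) ⊎ toℕ j ≡ suc (toℕ i)))

  IsPath : Set
  IsPath = Σ (List (Fin n)) λ P → IsInducedPath P × (∀ v → v ∈ₗ P)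

  -- Outerplanar: the vertices can be placed in a cyclic order (pos is a
  -- bijection onto positions 0..n-1 on a circle) such that the edges, drawn
  -- as chords, never cross. This is the combinatorial form of a planar
  -- embedding with all vertices on one (the outer) face.
  IsOuterplanar : Set
  IsOuterplanar = Σ (Fin n → Fin n) λ pos → Injective _≡_ _≡_ pos ×
    (∀ a b c d → E G a b → E G c d →
      ¬ (toℕ (pos a) < toℕ (pos c) × toℕ (pos c) < toℕ (pos b) × toℕ (pos b) < toℕ (pos d)))

  IsDoublePath : Set
  IsDoublePath = IsOuterplanar × ¬ IsPath ×
    Σ (List (Fin n)) λ P → Σ (List (Fin n)) λ Q →
      IsInducedPath P × IsInducedPath Q × Unique (P ++ Q) × (∀ v → v ∈ₗ (P ++ Q))

  data Black (S : Subset n) : Fin n → Set where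
    init  : ∀ {v} → v ∈ S → Black S v
    force : ∀ {u v} → Black S u → E G u v →
            (∀ w → E G u w → w ≢ v → Black S w) → Black S v

  IsZeroForcingSet : Subset n → Set
  IsZeroForcingSet S = ∀ v → Black S v

  ZeroForcingNumber≡ : ℕ → Set
  ZeroForcingNumber≡ k =
    (Σ (Subset n) λ S → IsZeroForcingSet S × ∣ S ∣ ≡ k) ×
    (∀ S → IsZeroForcingSet S → k ≤ ∣ S ∣)

{-# OPTIONS --safe #-}
module Submission where

-- A single vertex s can only force along a chain s = v₀, v₁, … in which every vᵢ has exactly one
-- neighbour outside {v₀, …, vᵢ}. If the chain gets stuck before exhausting V, its complement is a
-- fort (every vertex outside it has no or at least two neighbours in it), which forcing never
-- enters; otherwise the chain is an induced Hamiltonian path. Hence Z(G) ≥ 2 when G is not a path.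
--
-- For Z(G) ≤ 2, let P = p₀ … p_k and Q = q₀ … q_m be the two induced paths. In the cyclic order of
-- an outerplanar embedding, two vertex-disjoint walks have non-crossing end chords. Applied to P
-- and Q, and to the walks p₀ … p_i q_j' … q_m and q₀ … q_j p_i' … p_k formed by two crossed rungs
-- p_i q_j', p_i' q_j (i < i', j < j'), together with the fact that one of the three matchings of
-- four points on a circle crosses, this shows that after possibly reversing Q no two rungs cross.
-- Then {p₀, q₀} forces everything: p_i forces p_{i+1} once the Q-neighbours of p_i are black, and
-- those are reached by forcing along Q, since the P-neighbours of earlier vertices of Q precede p_i.

open import Defs renaming (sym to E-sym; irrefl to E-irrefl)

open import Data.Bool using (Bool; true; false; not; _xor_)
open import Data.Bool.Properties using (xor-same; xor-comm; xor-∧-commutativeRing)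
open import Data.Empty using (⊥; ⊥-elim)
open import Data.Fin using (Fin; toℕ; zero; suc; fromℕ<)
open import Data.Fin.Properties
  using (toℕ-injective; toℕ-fromℕ<; toℕ<n; any?; all?; ¬∀⟶∃¬; injective⇒≤; punchOut-injective; sequence)
  renaming (_≟_ to _≟ᶠ_)
open import Data.Fin.Subset using (Subset; ⁅_⁆; _∪_; ∣_∣; _⊆_) renaming (_∈_ to _∈ˢ_)
open import Data.Fin.Subset.Properties
  using (_∈?_; x∈⁅x⁆; x∈⁅y⁆⇒x≡y; x∈p∪q⁻; x∈p∪q⁺; ∣⁅x⁆∣≡1; ∪-identityˡ; ∪-identityʳ; p⊆q⇒∣p∣≤∣q∣)
open import Data.List using (List; []; _∷_; length; lookup; _++_)
open import Data.List.Properties using (++-identityʳ)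
open import Data.List.Membership.Propositional using () renaming (_∈_ to _∈ₗ_; _∉_ to _∉ₗ_)
open import Data.List.Membership.Propositional.Properties using (∈-lookup; ∈-++⁺ʳ; ∈-++⁻)
open import Data.List.Relation.Unary.All using () renaming (lookup to All-lookup)
open import Data.List.Relation.Unary.All.Properties.Core using (¬Any⇒All¬)
open import Data.List.Relation.Unary.AllPairs using (_∷_; [])
open import Data.List.Relation.Unary.Any using (here; there; index)
open import Data.List.Relation.Unary.Any.Properties using (lookup-index)
open import Data.List.Relation.Unary.Unique.Propositional using (Unique)
open import Data.Maybe using (just; nothing)
open import Data.Nat
  using (ℕ; zero; suc; _+_; _∸_; _≤_; _<_; _≤′_; ≤′-refl; ≤′-step; _<ᵇ_; z≤n; s≤s; s≤s⁻¹; z<s; _≤?_)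
open import Data.Nat.Properties
  using ( ≤-refl; ≤-antisym; <-trans; <-irrefl; <-asym; <-cmp; ≤-<-trans; <-≤-trans; <⇒≤; ≤∧≢⇒<; ≮⇒≥
        ; ≰⇒>; <⇒≱; n≮0; 0≢1+n; n≤1+n; m≤n⇒m≤1+n; m≤n⇒m<n∨m≡n; ≤′⇒≤; ≤⇒≤′; m≤m+n; +-suc; suc-injective
        ; +-∸-assoc; ∸-cancelˡ-≡; m∸n≤m; n∸n≡0; m∸[m∸n]≡n; <ᵇ-reflects-< )
open import Data.Product using (∃-syntax; _×_; _,_; proj₁; proj₂)
open import Data.Sum using (_⊎_; inj₁; inj₂)
import Data.Sum as Sum
open import Effect.Monad using (RawMonad)
open import Function using (_∘_)
open import Function.Bundles using (_⇔_; mk⇔; Equivalence)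
open import Level using (0ℓ)
open import Relation.Binary.Construct.Closure.ReflexiveTransitive using (Star; ε; _◅_; _◅◅_; fold)
open import Relation.Binary.Definitions using (tri<; tri≈; tri>)
open import Relation.Binary.PropositionalEquality
  using (_≡_; _≢_; refl; sym; trans; cong; subst; module ≡-Reasoning)
open import Relation.Nullary using (¬_; Dec; yes; no; contradiction)
open import Relation.Nullary.Decidable using (decidable-stable; ¬?; _×-dec_; ¬¬-excluded-middle)
open import Relation.Nullary.Negation using (¬¬-Monad)
open import Relation.Nullary.Reflects using (ofʸ; ofⁿ)
open import Tactic.RingSolver using (solve-∀)
open import Tactic.RingSolver.Core.AlmostCommutativeRing using (AlmostCommutativeRing; fromCommutativeRing)

lookup-injective : ∀ {A : Set} {xs : List A} → Unique xs → ∀ {i j} → lookup xs i ≡ lookup xs j → i ≡ j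
lookup-injective (_   ∷ _)      {zero}  {zero}  _  = refl
lookup-injective (x≢ ∷ _)      {zero}  {suc j} eq = contradiction eq (All-lookup x≢ (∈-lookup j))
lookup-injective (x≢ ∷ _)      {suc i} {zero}  eq = contradiction (sym eq) (All-lookup x≢ (∈-lookup i))
lookup-injective (_   ∷ unique) {suc i} {suc j} eq = cong suc (lookup-injective unique eq)

unique∧∉⇒length< : ∀ {n} {xs : List (Fin n)} {v} → Unique xs → v ∉ₗ xs → length xs < n
unique∧∉⇒length< {suc _} {xs} {v} unique v∉xs =
  s≤s (injective⇒≤ λ eq → lookup-injective unique (punchOut-injective (v≢ _) (v≢ _) eq))
  where
  v≢ : ∀ i → v ≢ lookup xs i
  v≢ i v≡ = v∉xs (subst (_∈ₗ xs) (sym v≡) (∈-lookup i))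

++-unique⇒disjoint : ∀ {A : Set} {xs ys : List A} {v} → Unique (xs ++ ys) → v ∈ₗ xs → ¬ v ∈ₗ ys
++-unique⇒disjoint {xs = _ ∷ xs} (x∉ ∷ _)      (here refl)  v∈ys = All-lookup x∉ (∈-++⁺ʳ xs v∈ys) refl
++-unique⇒disjoint {xs = _ ∷ _}  (_ ∷ unique) (there v∈xs) = ++-unique⇒disjoint unique v∈xs

nth : {A : Set} → A → List A → ℕ → A
nth d []       _       = d
nth d (x ∷ xs) zero    = x
nth d (x ∷ xs) (suc i) = nth d xs i

nth-lookup : ∀ {A : Set} (d : A) xs (i : Fin (length xs)) → nth d xs (toℕ i) ≡ lookup xs i
nth-lookup d (x ∷ xs) zero    = refl
nth-lookup d (x ∷ xs) (suc i) = nth-lookup d xs i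

toℕ-surjective : ∀ {L i} → i < L → ∃[ f ] toℕ {L} f ≡ i
toℕ-surjective i<L = fromℕ< i<L , toℕ-fromℕ< i<L

nth-∈ : ∀ {A : Set} (d : A) xs {i} → i < length xs → nth d xs i ∈ₗ xs
nth-∈ d xs i< with f , refl ← toℕ-surjective i< = subst (_∈ₗ xs) (sym (nth-lookup d xs f)) (∈-lookup f)

∣⁅x⁆∪⁅y⁆∣≡2 : ∀ {n} {x y : Fin n} → x ≢ y → ∣ ⁅ x ⁆ ∪ ⁅ y ⁆ ∣ ≡ 2
∣⁅x⁆∪⁅y⁆∣≡2 {x = zero}  {zero}  x≢y = contradiction refl x≢y
∣⁅x⁆∪⁅y⁆∣≡2 {x = zero}  {suc y} _   = cong suc (trans (cong ∣_∣ (∪-identityˡ ⁅ y ⁆)) (∣⁅x⁆∣≡1 y))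
∣⁅x⁆∪⁅y⁆∣≡2 {x = suc x} {zero}  _   = cong suc (trans (cong ∣_∣ (∪-identityʳ ⁅ x ⁆)) (∣⁅x⁆∣≡1 x))
∣⁅x⁆∪⁅y⁆∣≡2 {x = suc x} {suc y} x≢y = ∣⁅x⁆∪⁅y⁆∣≡2 (x≢y ∘ cong suc)

∣S∣<2⇒S⊆⁅s⁆ : ∀ {n} {S : Subset n} → ¬ 2 ≤ ∣ S ∣ → Fin n → ∃[ s ] S ⊆ ⁅ s ⁆
∣S∣<2⇒S⊆⁅s⁆ {S = S} ∣S∣<2 v with any? (_∈? S)
... | no  S-empty    = v , λ {x} x∈S → contradiction (x , x∈S) S-empty
... | yes (s , s∈S) = s , λ {x} x∈S → subst (_∈ˢ ⁅ s ⁆) (sym (only-s x∈S)) (x∈⁅x⁆ s)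
  where
  only-s : ∀ {x} → x ∈ˢ S → x ≡ s
  only-s {x} x∈S = decidable-stable (x ≟ᶠ s) λ x≢s →
    ∣S∣<2 (subst (_≤ ∣ S ∣) (∣⁅x⁆∪⁅y⁆∣≡2 x≢s) (p⊆q⇒∣p∣≤∣q∣ pair⊆S))
    where
    pair⊆S : ⁅ x ⁆ ∪ ⁅ s ⁆ ⊆ S
    pair⊆S {y} y∈ with x∈p∪q⁻ ⁅ x ⁆ ⁅ s ⁆ y∈
    ... | inj₁ y∈⁅x⁆ = subst (_∈ˢ S) (sym (x∈⁅y⁆⇒x≡y x y∈⁅x⁆)) x∈S
    ... | inj₂ y∈⁅s⁆ = subst (_∈ˢ S) (sym (x∈⁅y⁆⇒x≡y s y∈⁅s⁆)) s∈S

unique⊎paired : ∀ {n} {P : Fin n → Set} → (∀ v → Dec (P v)) →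
                (∃[ w ] P w × ∀ {w'} → P w' → w' ≡ w) ⊎ (∀ {v} → P v → ∃[ w ] P w × w ≢ v)
unique⊎paired {P = P} P? with any? P?
... | no  none       = inj₂ λ {v} Pv → contradiction (v , Pv) none
... | yes (w , Pw) with any? (λ w' → P? w' ×-dec ¬? (w' ≟ᶠ w))
...   | yes (w' , Pw' , w'≢w) = inj₂ λ {v} _ → partner (v ≟ᶠ w)
  where
  partner : ∀ {v} → Dec (v ≡ w) → ∃[ u ] P u × u ≢ v
  partner (yes refl) = w' , Pw' , w'≢w
  partner (no  v≢w)  = w , Pw , v≢w ∘ sym
...   | no  no-other =
  inj₁ (w , Pw , λ {w'} Pw' → decidable-stable (w' ≟ᶠ w) λ w'≢w → no-other (w' , Pw' , w'≢w))

-- Chords of a circle cut open into a line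

-- For c ∉ {a, b}, between a b c says that c lies strictly between a and b. Chords ab and cd with
-- four distinct ends cross iff exactly one of c, d lies between a and b, so crossing is the parity
-- of four comparisons, and reversing a comparison negates it.
between : ℕ → ℕ → ℕ → Bool
between a b c = (a <ᵇ c) xor (b <ᵇ c)

<ᵇ-flip : ∀ {a b} → a ≢ b → (b <ᵇ a) ≡ not (a <ᵇ b)
<ᵇ-flip {a} {b} a≢b with a <ᵇ b | <ᵇ-reflects-< a b | b <ᵇ a | <ᵇ-reflects-< b a
... | true  | ofʸ a<b | true  | ofʸ b<a = contradiction a<b (<-asym b<a)
... | true  | _       | false | _       = refl
... | false | _       | true  | _       = refl
... | false | ofⁿ a≮b | false | ofⁿ b≮a = contradiction (≤-antisym (≮⇒≥ b≮a) (≮⇒≥ a≮b)) a≢b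

between-placement : ∀ {a b c} → a < b → c ≢ a → c ≢ b →
                    (a < c × c < b × between a b c ≡ true) ⊎ ((c < a ⊎ b < c) × between a b c ≡ false)
between-placement {a} {b} {c} a<b c≢a c≢b with a <ᵇ c | <ᵇ-reflects-< a c | b <ᵇ c | <ᵇ-reflects-< b c
... | true  | ofʸ a<c | true  | ofʸ b<c = inj₂ (inj₂ b<c , refl)
... | true  | ofʸ a<c | false | ofⁿ b≮c = inj₁ (a<c , ≤∧≢⇒< (≮⇒≥ b≮c) c≢b , refl)
... | false | ofⁿ a≮c | true  | ofʸ b<c = contradiction (<-trans a<b b<c) a≮c
... | false | ofⁿ a≮c | false | _       = inj₂ (inj₁ (≤∧≢⇒< (≮⇒≥ a≮c) c≢a) , refl)

≡⇒xor≡false : ∀ {x y} → x ≡ y → x xor y ≡ false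
≡⇒xor≡false {x} refl = xor-same x

xor≡false⇒≡ : ∀ {x y} → x xor y ≡ false → x ≡ y
xor≡false⇒≡ {false} {false} _ = refl
xor≡false⇒≡ {true}  {true}  _ = refl

one-of-last-two : ∀ {x y z} → x xor y xor z ≡ true → x ≡ false → y ≡ true ⊎ z ≡ true
one-of-last-two {false} {true}         _ _ = inj₁ refl
one-of-last-two {false} {false} {true} _ _ = inj₂ refl

-- Negations are written true xor x, so that the ring solver sees terms of the Boolean ring.
private
  Bool-ring : AlmostCommutativeRing 0ℓ 0ℓ
  Bool-ring = fromCommutativeRing xor-∧-commutativeRing λ { false → just refl ; true → nothing }

  flip-four : ∀ w x y z → (w xor x) xor (y xor z) ≡
              ((true xor w) xor (true xor y)) xor ((true xor x) xor (true xor z))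
  flip-four = solve-∀ Bool-ring

  three-matchings : ∀ ab ac ad bc bd cd →
    ((ac xor bc) xor (ad xor bd)) xor ((ad xor cd) xor (ab xor (true xor bc)))
      xor ((ac xor (true xor cd)) xor (ab xor (true xor bd))) ≡ true
  three-matchings = solve-∀ Bool-ring

module _ {n : ℕ} (G : Graph n) where

  open import Data.List.Membership.DecPropositional (_≟ᶠ_ {n}) using () renaming (_∈?_ to _∈ₗ?_)

  private
    V : Set
    V = Fin n

    _~_ : V → V → Set
    _~_ = E G

  -- Forts and the lower bound

  Black-mono : ∀ {S T} → S ⊆ T → ∀ {v} → Black G S v → Black G T v
  Black-mono S⊆T (init v∈S)               = init (S⊆T v∈S)
  Black-mono S⊆T (force u-black u~v rest) =
    force (Black-mono S⊆T u-black) u~v λ w u~w w≢v → Black-mono S⊆T (rest w u~w w≢v)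

  IsFort : (V → Set) → Set
  IsFort F = ∀ {u v} → ¬ F u → u ~ v → F v → ∃[ w ] u ~ w × w ≢ v × F w

  fort-stays-white : ∀ {F S} → IsFort F → (∀ {x} → x ∈ˢ S → ¬ F x) → ∀ {v} → Black G S v → ¬ F v
  fort-stays-white fort S∩F=∅ (init v∈S) = S∩F=∅ v∈S
  fort-stays-white fort S∩F=∅ (force u-black u~v rest) Fv
    with w , u~w , w≢v , Fw ← fort (fort-stays-white fort S∩F=∅ u-black) u~v Fv
    = fort-stays-white fort S∩F=∅ (rest w u~w w≢v) Fw

  ∷-induced : ∀ {x xs} → IsInducedPath G xs → x ∉ₗ xs →
              (∀ i → x ~ lookup xs i ⇔ toℕ i ≡ 0) → IsInducedPath G (x ∷ xs)
  ∷-induced {x} {xs} (unique , adjacent⇔) x∉xs x-adjacent⇔ = ¬Any⇒All¬ xs x∉xs ∷ unique , adjacent⇔′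
    where
    adjacent⇔′ : ∀ i j → lookup (x ∷ xs) i ~ lookup (x ∷ xs) j ⇔ (toℕ i ≡ suc (toℕ j) ⊎ toℕ j ≡ suc (toℕ i))
    adjacent⇔′ zero    zero    = mk⇔ (⊥-elim ∘ E-irrefl G) λ { (inj₁ ()) ; (inj₂ ()) }
    adjacent⇔′ zero    (suc j) = mk⇔
      (λ x~j → inj₂ (cong suc (Equivalence.to (x-adjacent⇔ j) x~j)))
      λ { (inj₁ ()) ; (inj₂ j≡0) → Equivalence.from (x-adjacent⇔ j) (suc-injective j≡0) }
    adjacent⇔′ (suc i) zero    = mk⇔
      (λ i~x → inj₁ (cong suc (Equivalence.to (x-adjacent⇔ i) (E-sym G i~x))))
      λ { (inj₁ i≡0) → E-sym G (Equivalence.from (x-adjacent⇔ i) (suc-injective i≡0)) ; (inj₂ ()) }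
    adjacent⇔′ (suc i) (suc j) = mk⇔
      (Sum.map (cong suc) (cong suc) ∘ Equivalence.to (adjacent⇔ i j))
      (Equivalence.from (adjacent⇔ i j) ∘ Sum.map suc-injective suc-injective)

  module ForcingChain (E? : ∀ u v → Dec (u ~ v)) (s : V) where

    -- A forcing chain from s, listed from its head h back to s.
    record Chain (h : V) (rest : List V) : Set where
      field
        induced : IsInducedPath G (h ∷ rest)
        source  : s ∈ₗ h ∷ rest
        closed  : ∀ {u v} → u ∈ₗ rest → u ~ v → v ∈ₗ h ∷ rest
    open Chain

    start : Chain s []
    start = record
      { induced = ∷-induced ([] , λ ()) (λ ()) (λ ())
      ; source  = here refl
      ; closed  = λ ()
      }

    OutsideNeighbour : V → List V → V → Set
    OutsideNeighbour h cs w = h ~ w × w ∉ₗ cs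

    extend : ∀ {h rest w} → Chain h rest → OutsideNeighbour h (h ∷ rest) w →
             (∀ {w'} → OutsideNeighbour h (h ∷ rest) w' → w' ≡ w) → Chain w (h ∷ rest)
    extend {h} {rest} {w} chain (h~w , w∉) only-w = record
      { induced = ∷-induced (induced chain) w∉ λ
          { zero    → mk⇔ (λ _ → refl) (λ _ → E-sym G h~w)
          ; (suc i) → mk⇔ (λ w~u → contradiction (closed chain (∈-lookup i) (E-sym G w~u)) w∉) λ ()
          }
      ; source  = there (source chain)
      ; closed  = closed′
      }
      where
      closed′ : ∀ {u v} → u ∈ₗ h ∷ rest → u ~ v → v ∈ₗ w ∷ h ∷ rest
      closed′ {v = v} (here refl) h~v with v ∈ₗ? h ∷ rest
      ... | yes v∈ = there v∈
      ... | no  v∉ = here (only-w (h~v , v∉))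
      closed′ (there u∈) u~v = there (closed chain u∈ u~v)

    stuck-fort : ∀ {h rest} → Chain h rest →
                 (∀ {v} → OutsideNeighbour h (h ∷ rest) v → ∃[ w ] OutsideNeighbour h (h ∷ rest) w × w ≢ v) →
                 IsFort (_∉ₗ h ∷ rest)
    stuck-fort {h} {rest} chain paired {u} {v} ¬u∉ u~v v∉ with decidable-stable (u ∈ₗ? h ∷ rest) ¬u∉
    ... | here refl = let w , (h~w , w∉) , w≢v = paired (u~v , v∉) in w , h~w , w≢v , w∉
    ... | there u∈  = contradiction (closed chain u∈ u~v) v∉

    grow : IsZeroForcingSet G ⁅ s ⁆ → ∀ fuel {h rest} → n ≤ fuel + length (h ∷ rest) → Chain h rest → IsPath G
    grow forcing fuel {h} {rest} bound chain with all? (_∈ₗ? h ∷ rest)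
    ... | yes covers = h ∷ rest , induced chain , covers
    ... | no ¬covers with v , v∉ ← ¬∀⟶∃¬ n _ (_∈ₗ? h ∷ rest) ¬covers
        with unique⊎paired (λ w → E? h w ×-dec ¬? (w ∈ₗ? h ∷ rest)) | fuel
    ... | inj₂ paired | _ = contradiction v∉ (fort-stays-white (stuck-fort chain paired) s-on-chain (forcing v))
      where
      s-on-chain : ∀ {x} → x ∈ˢ ⁅ s ⁆ → ¬ x ∉ₗ h ∷ rest
      s-on-chain x∈ x∉ = x∉ (subst (_∈ₗ h ∷ rest) (sym (x∈⁅y⁆⇒x≡y s x∈)) (source chain))
    ... | inj₁ _ | zero = contradiction bound (<⇒≱ (unique∧∉⇒length< (proj₁ (induced chain)) v∉))
    ... | inj₁ (w , outside , only-w) | suc fuel =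
      grow forcing fuel (subst (n ≤_) (sym (+-suc fuel _)) bound) (extend chain outside only-w)

  singleton-forcing⇒path : (∀ u v → Dec (u ~ v)) → ∀ {s} → IsZeroForcingSet G ⁅ s ⁆ → IsPath G
  singleton-forcing⇒path E? {s} forcing = grow forcing n (m≤m+n n 1) start
    where open ForcingChain E? s

  -- Adjacency need not be decidable, but the goal is negative, and ¬¬ commutes with finite products.
  non-path⇒Z≥2 : ¬ IsPath G → V → ∀ S → IsZeroForcingSet G S → 2 ≤ ∣ S ∣
  non-path⇒Z≥2 not-path v S forcing with 2 ≤? ∣ S ∣
  ... | yes 2≤∣S∣ = 2≤∣S∣
  ... | no  ∣S∣<2 with s , S⊆⁅s⁆ ← ∣S∣<2⇒S⊆⁅s⁆ ∣S∣<2 v =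
    ⊥-elim (adjacency-decidable λ E? → not-path (singleton-forcing⇒path E? (Black-mono S⊆⁅s⁆ ∘ forcing)))
    where
    open RawMonad ¬¬-Monad using (rawApplicative)
    adjacency-decidable : ¬ ¬ (∀ u v → Dec (u ~ v))
    adjacency-decidable = sequence rawApplicative λ u → sequence rawApplicative λ v → ¬¬-excluded-middle

  -- Induced paths indexed by ℕ

  record IndexedPath (k : ℕ) : Set where
    field
      vertex    : ℕ → V
      adjacent⇔ : ∀ {i j} → i < k → j < k → vertex i ~ vertex j ⇔ (i ≡ suc j ⊎ j ≡ suc i)
      injective : ∀ {i j} → i < k → j < k → vertex i ≡ vertex j → i ≡ j
  open IndexedPath

  module _ {k : ℕ} (R : IndexedPath k) where

    step-adjacent : ∀ {i} → suc i < k → vertex R i ~ vertex R (suc i)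
    step-adjacent si<k = Equivalence.from (adjacent⇔ R (<⇒≤ si<k) si<k) (inj₂ refl)

    OnPath : V → Set
    OnPath v = ∃[ i ] i < k × vertex R i ≡ v

    Segment : ℕ → ℕ → V → Set
    Segment a b v = ∃[ t ] a ≤ t × t ≤ b × vertex R t ≡ v

  in-segment : ∀ {k a b t} (R : IndexedPath k) → a ≤ t → t ≤ b → Segment R a b (vertex R t)
  in-segment {t = t} R a≤t t≤b = t , a≤t , t≤b , refl

  segments-apart : ∀ {k a b c d v} (R : IndexedPath k) → b < c → d < k → Segment R a b v → ¬ Segment R c d v
  segments-apart R b<c d<k (t , _ , t≤b , refl) (t' , c≤t' , t'≤d , eq) =
    <-irrefl (injective R (<-trans t<t' t'<k) t'<k (sym eq)) t<t'
    where
    t<t' : t < t'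
    t<t' = ≤-<-trans t≤b (<-≤-trans b<c c≤t')
    t'<k : t' < _
    t'<k = ≤-<-trans t'≤d d<k

  module _ {k m : ℕ} (P : IndexedPath k) (Q : IndexedPath m) where

    Disjoint : Set
    Disjoint = ∀ {i j} → i < k → j < m → vertex P i ≢ vertex Q j

    Covering : Set
    Covering = ∀ v → OnPath P v ⊎ OnPath Q v

    Parallel : Set
    Parallel = ∀ {i i' j j'} → i < i' → i' < k → j < j' → j' < m →
               vertex P i ~ vertex Q j' → vertex P i' ~ vertex Q j → ⊥

  disjoint-segments-apart : ∀ {k m a b c d v} (P : IndexedPath k) (Q : IndexedPath m) → Disjoint P Q →
                            b < k → d < m → Segment P a b v → ¬ Segment Q c d v
  disjoint-segments-apart P Q P∩Q=∅ b<k d<m (t , _ , t≤b , refl) (t' , _ , t'≤d , eq) =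
    P∩Q=∅ (≤-<-trans t≤b b<k) (≤-<-trans t'≤d d<m) (sym eq)

  ∸≡suc∸⇔ : ∀ {k i j} → i ≤ k → j ≤ k → k ∸ i ≡ suc (k ∸ j) ⇔ j ≡ suc i
  ∸≡suc∸⇔ {k} {i} {j} i≤k j≤k = mk⇔
    (λ eq → sym (∸-cancelˡ-≡ (s≤s i≤k) (m≤n⇒m≤1+n j≤k) (trans eq (sym (+-∸-assoc 1 j≤k)))))
    (λ { refl → +-∸-assoc 1 j≤k })

  reverse : ∀ {k} → IndexedPath (suc k) → IndexedPath (suc k)
  reverse {k} R = record
    { vertex    = λ i → vertex R (k ∸ i)
    ; adjacent⇔ = λ { {i} {j} (s≤s i≤k) (s≤s j≤k) → mk⇔
        (Sum.swap ∘ Sum.map (Equivalence.to (∸≡suc∸⇔ i≤k j≤k)) (Equivalence.to (∸≡suc∸⇔ j≤k i≤k))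
                  ∘ Equivalence.to (adjacent⇔ R (in-range i) (in-range j)))
        (Equivalence.from (adjacent⇔ R (in-range i) (in-range j))
          ∘ Sum.map (Equivalence.from (∸≡suc∸⇔ i≤k j≤k)) (Equivalence.from (∸≡suc∸⇔ j≤k i≤k)) ∘ Sum.swap) }
    ; injective = λ { {i} {j} (s≤s i≤k) (s≤s j≤k) →
        ∸-cancelˡ-≡ i≤k j≤k ∘ injective R (in-range i) (in-range j) }
    }
    where
    in-range : ∀ i → k ∸ i < suc k
    in-range i = s≤s (m∸n≤m k i)

  reverse-last : ∀ {k} (R : IndexedPath (suc k)) → vertex (reverse R) k ≡ vertex R 0
  reverse-last {k} R = cong (vertex R) (n∸n≡0 k)

  reverse-onPath : ∀ {k v} (R : IndexedPath (suc k)) → OnPath R v → OnPath (reverse R) v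
  reverse-onPath {k} R (i , s≤s i≤k , refl) = k ∸ i , s≤s (m∸n≤m k i) , cong (vertex R) (m∸[m∸n]≡n i≤k)

  reverse-disjoint : ∀ {k m} (P : IndexedPath k) (Q : IndexedPath (suc m)) → Disjoint P Q → Disjoint P (reverse Q)
  reverse-disjoint {m = m} P Q P∩Q=∅ {j = j} i<k _ = P∩Q=∅ i<k (s≤s (m∸n≤m m j))

  fromInducedList : ∀ d {xs} → IsInducedPath G xs → IndexedPath (length xs)
  fromInducedList d {xs} (unique , adjacent⇔) = record
    { vertex = nth d xs ; adjacent⇔ = adjacent⇔′ ; injective = injective′ }
    where
    adjacent⇔′ : ∀ {i j} → i < length xs → j < length xs → nth d xs i ~ nth d xs j ⇔ (i ≡ suc j ⊎ j ≡ suc i)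
    adjacent⇔′ i< j< with f , refl ← toℕ-surjective i< | g , refl ← toℕ-surjective j<
      rewrite nth-lookup d xs f | nth-lookup d xs g = adjacent⇔ f g
    injective′ : ∀ {i j} → i < length xs → j < length xs → nth d xs i ≡ nth d xs j → i ≡ j
    injective′ i< j< with f , refl ← toℕ-surjective i< | g , refl ← toℕ-surjective j<
      rewrite nth-lookup d xs f | nth-lookup d xs g = cong toℕ ∘ lookup-injective unique

  ∈⇒OnPath : ∀ d {xs v} (induced : IsInducedPath G xs) → v ∈ₗ xs → OnPath (fromInducedList d induced) v
  ∈⇒OnPath d {xs} _ v∈ = toℕ (index v∈) , toℕ<n _ , trans (nth-lookup d xs _) (sym (lookup-index v∈))

  -- Forcing along two parallel paths

  module _ {S : Subset n} where

    BlackUpTo : ∀ {k} → IndexedPath k → ℕ → Set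
    BlackUpTo R i = ∀ {a} → a ≤ i → Black G S (vertex R a)

    black-start : ∀ {k} (R : IndexedPath k) → Black G S (vertex R 0) → BlackUpTo R 0
    black-start R black z≤n = black

    force-next : ∀ {k m i} (R : IndexedPath k) (R' : IndexedPath m) → Covering R R' → suc i < k →
                 BlackUpTo R i → (∀ {j} → j < m → vertex R i ~ vertex R' j → Black G S (vertex R' j)) →
                 BlackUpTo R (suc i)
    force-next {i = i} R R' cover si<k prefix R'-neighbours a≤si with m≤n⇒m<n∨m≡n a≤si
    ... | inj₁ a<si = prefix (s≤s⁻¹ a<si)
    ... | inj₂ refl = force (prefix ≤-refl) (step-adjacent R si<k) others
      where
      others : ∀ w → vertex R i ~ w → w ≢ vertex R (suc i) → Black G S w
      others w i~w w≢ with cover w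
      ... | inj₂ (j , j<m , refl) = R'-neighbours j<m i~w
      ... | inj₁ (b , b<k , refl) with Equivalence.to (adjacent⇔ R (<⇒≤ si<k) b<k) i~w
      ...   | inj₁ refl = prefix (n≤1+n b)
      ...   | inj₂ refl = contradiction refl w≢

  parallel-paths-forced-from-starts : ∀ {k m} (P : IndexedPath k) (Q : IndexedPath m) →
    Covering P Q → Parallel P Q → IsZeroForcingSet G (⁅ vertex P 0 ⁆ ∪ ⁅ vertex Q 0 ⁆)
  parallel-paths-forced-from-starts {k} {m} P Q cover parallel = forced
    where
    S : Subset n
    S = ⁅ vertex P 0 ⁆ ∪ ⁅ vertex Q 0 ⁆

    cover′ : Covering Q P
    cover′ = Sum.swap ∘ cover

    Q-black-below-rung : ∀ {i j'} → BlackUpTo {S} P i → i < k → j' < m → vertex P i ~ vertex Q j' →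
                         ∀ t → t ≤ j' → BlackUpTo {S} Q t
    Q-black-below-rung _ _ _ _ zero _ = black-start Q (init (x∈p∪q⁺ (inj₂ (x∈⁅x⁆ _))))
    Q-black-below-rung {i} {j'} P-black i<k j'<m rung (suc t) t<j' =
      force-next Q P cover′ (≤-<-trans t<j' j'<m)
        (Q-black-below-rung P-black i<k j'<m rung t (<⇒≤ t<j')) P-neighbours
      where
      P-neighbours : ∀ {b} → b < k → vertex Q t ~ vertex P b → Black G S (vertex P b)
      P-neighbours {b} b<k t~b with b ≤? i
      ... | yes b≤i = P-black b≤i
      ... | no  b≰i = ⊥-elim (parallel (≰⇒> b≰i) b<k t<j' j'<m rung (E-sym G t~b))

    P-black : ∀ i → i < k → BlackUpTo {S} P i
    P-black zero    _    = black-start P (init (x∈p∪q⁺ (inj₁ (x∈⁅x⁆ _))))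
    P-black (suc i) si<k = force-next P Q cover si<k (P-black i (<⇒≤ si<k))
      λ j<m rung → Q-black-below-rung (P-black i (<⇒≤ si<k)) (<⇒≤ si<k) j<m rung _ ≤-refl ≤-refl

    Q-black : ∀ j → j < m → BlackUpTo {S} Q j
    Q-black zero    _    = black-start Q (init (x∈p∪q⁺ (inj₂ (x∈⁅x⁆ _))))
    Q-black (suc j) sj<m = force-next Q P cover′ sj<m (Q-black j (<⇒≤ sj<m)) λ b<k _ → P-black _ b<k ≤-refl

    forced : IsZeroForcingSet G S
    forced v with cover v
    ... | inj₁ (i , i<k , refl) = P-black i i<k ≤-refl
    ... | inj₂ (j , j<m , refl) = Q-black j j<m ≤-refl

  -- Chords of the outerplanar embedding

  module Chords (outerplanar : IsOuterplanar G) where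

    private
      pos : V → Fin n
      pos = proj₁ outerplanar

    π : V → ℕ
    π v = toℕ (pos v)

    private
      no-crossing : ∀ a b c d → a ~ b → c ~ d → ¬ (π a < π c × π c < π b × π b < π d)
      no-crossing = proj₂ (proj₂ outerplanar)

    π-≢ : ∀ {u v} → u ≢ v → π u ≢ π v
    π-≢ u≢v = u≢v ∘ proj₁ (proj₂ outerplanar) ∘ toℕ-injective

    side : V → V → V → Bool
    side x y v = between (π x) (π y) (π v)

    crosses : V → V → V → V → Bool
    crosses a b c d = side a b c xor side a b d

    edges-not-interleaved : ∀ {x y u v} → x ~ y → u ~ v → π x < π u → π u < π y → π v < π x ⊎ π y < π v → ⊥
    edges-not-interleaved x~y u~v x<u u<y (inj₁ v<x) = no-crossing _ _ _ _ (E-sym G u~v) x~y (v<x , x<u , u<y)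
    edges-not-interleaved x~y u~v x<u u<y (inj₂ y<v) = no-crossing _ _ _ _ x~y u~v (x<u , u<y , y<v)

    edge-keeps-side-< : ∀ {x y u v} → x ~ y → u ~ v → π x < π y →
                        u ≢ x → u ≢ y → v ≢ x → v ≢ y → side x y u ≡ side x y v
    edge-keeps-side-< x~y u~v x<y u≢x u≢y v≢x v≢y
      with between-placement x<y (π-≢ u≢x) (π-≢ u≢y) | between-placement x<y (π-≢ v≢x) (π-≢ v≢y)
    ... | inj₁ (_ , _ , u-in)  | inj₁ (_ , _ , v-in)  = trans u-in (sym v-in)
    ... | inj₂ (_ , u-out)     | inj₂ (_ , v-out)     = trans u-out (sym v-out)
    ... | inj₁ (x<u , u<y , _) | inj₂ (v-outside , _) = ⊥-elim (edges-not-interleaved x~y u~v x<u u<y v-outside)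
    ... | inj₂ (u-outside , _) | inj₁ (x<v , v<y , _) =
      ⊥-elim (edges-not-interleaved x~y (E-sym G u~v) x<v v<y u-outside)

    edge-keeps-side : ∀ {x y u v} → x ~ y → u ~ v → u ≢ x → u ≢ y → v ≢ x → v ≢ y → side x y u ≡ side x y v
    edge-keeps-side {x} {y} {u} {v} x~y u~v u≢x u≢y v≢x v≢y with <-cmp (π x) (π y)
    ... | tri< x<y _ _   = edge-keeps-side-< x~y u~v x<y u≢x u≢y v≢x v≢y
    ... | tri≈ _ πx≡πy _ = ⊥-elim (π-≢ (λ { refl → E-irrefl G x~y }) πx≡πy)
    ... | tri> _ _ y<x   = begin
      side x y u ≡⟨ xor-comm (π x <ᵇ π u) _ ⟩
      side y x u ≡⟨ edge-keeps-side-< (E-sym G x~y) u~v y<x u≢y u≢x v≢y v≢x ⟩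
      side y x v ≡⟨ xor-comm (π y <ᵇ π v) _ ⟩
      side x y v ∎
      where open ≡-Reasoning

    crosses-sym : ∀ {a b c d} → a ≢ c → a ≢ d → b ≢ c → b ≢ d → crosses a b c d ≡ crosses c d a b
    crosses-sym {a} {b} {c} {d} a≢c a≢d b≢c b≢d
      rewrite <ᵇ-flip (π-≢ a≢c) | <ᵇ-flip (π-≢ a≢d) | <ᵇ-flip (π-≢ b≢c) | <ᵇ-flip (π-≢ b≢d) =
      flip-four (π a <ᵇ π c) (π b <ᵇ π c) (π a <ᵇ π d) (π b <ᵇ π d)

    some-matching-crosses : ∀ {a b c d} → b ≢ c → b ≢ d → c ≢ d →
                            crosses a b c d xor crosses a c d b xor crosses a d c b ≡ true
    some-matching-crosses {a} {b} {c} {d} b≢c b≢d c≢d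
      rewrite <ᵇ-flip (π-≢ b≢c) | <ᵇ-flip (π-≢ b≢d) | <ᵇ-flip (π-≢ c≢d) =
      three-matchings (π a <ᵇ π b) (π a <ᵇ π c) (π a <ᵇ π d) (π b <ᵇ π c) (π b <ᵇ π d) (π c <ᵇ π d)

    Walk : (V → Set) → V → V → Set
    Walk A = Star λ u v → A u × A v × u ~ v

    private
      apart : ∀ {A : V → Set} {u v} → A u → ¬ A v → u ≢ v
      apart Au ¬Av refl = ¬Av Au

    side-constant-along : ∀ {A c c' a b} → c ~ c' → ¬ A c → ¬ A c' → Walk A a b → side c c' a ≡ side c c' b
    side-constant-along {A} {c} {c'} c~c' ¬Ac ¬Ac' = fold (λ u v → side c c' u ≡ side c c' v) step refl
      where
      step : ∀ {u v w} → A u × A v × u ~ v → side c c' v ≡ side c c' w → side c c' u ≡ side c c' w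
      step (Au , Av , u~v) = trans (edge-keeps-side c~c' u~v
        (apart Au ¬Ac) (apart Au ¬Ac') (apart Av ¬Ac) (apart Av ¬Ac'))

    disjoint-walks-do-not-cross : ∀ {A B a b c d} → (∀ {v} → A v → ¬ B v) → A a → A b →
                                  Walk A a b → Walk B c d → crosses a b c d ≡ false
    disjoint-walks-do-not-cross {A} {B} {a} {b} A∩B=∅ Aa Ab W =
      ≡⇒xor≡false ∘ fold (λ u v → side a b u ≡ side a b v) step refl
      where
      step : ∀ {c c' d} → B c × B c' × c ~ c' → side a b c' ≡ side a b d → side a b c ≡ side a b d
      step {c} {c'} (Bc , Bc' , c~c') = trans (xor≡false⇒≡ (begin
        crosses a b c c' ≡⟨ crosses-sym (apart Aa ¬Ac) (apart Aa ¬Ac') (apart Ab ¬Ac) (apart Ab ¬Ac') ⟩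
        crosses c c' a b ≡⟨ ≡⇒xor≡false (side-constant-along c~c' ¬Ac ¬Ac' W) ⟩
        false            ∎))
        where
        open ≡-Reasoning
        ¬Ac : ¬ A c
        ¬Ac Ac = A∩B=∅ Ac Bc
        ¬Ac' : ¬ A c'
        ¬Ac' Ac' = A∩B=∅ Ac' Bc'

    segment-walk : ∀ {k A a b} (R : IndexedPath k) → (∀ {t} → a ≤ t → t ≤ b → A (vertex R t)) →
                   a ≤′ b → b < k → Walk A (vertex R a) (vertex R b)
    segment-walk R within ≤′-refl         _    = ε
    segment-walk R within (≤′-step a≤′b) sb<k =
      segment-walk R (λ a≤t t≤b → within a≤t (m≤n⇒m≤1+n t≤b)) a≤′b (<⇒≤ sb<k)
      ◅◅ ((within (≤′⇒≤ a≤′b) (n≤1+n _) , within (≤′⇒≤ (≤′-step a≤′b)) ≤-refl , step-adjacent R sb<k) ◅ ε)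

    whole-walk : ∀ {k} (R : IndexedPath (suc k)) → Walk (Segment R 0 k) (vertex R 0) (vertex R k)
    whole-walk R = segment-walk R (in-segment R) (≤⇒≤′ z≤n) ≤-refl

    module _ {k m} (P : IndexedPath (suc k)) (Q : IndexedPath (suc m)) (P∩Q=∅ : Disjoint P Q) where

      ends-do-not-cross : crosses (vertex P 0) (vertex P k) (vertex Q 0) (vertex Q m) ≡ false
      ends-do-not-cross = disjoint-walks-do-not-cross (disjoint-segments-apart P Q P∩Q=∅ ≤-refl ≤-refl)
        (in-segment P z≤n z≤n) (in-segment P z≤n ≤-refl) (whole-walk P) (whole-walk Q)

      crossed-rungs-keep-ends-apart : ∀ {i i' j j'} → i < i' → i' < suc k → j < j' → j' < suc m →
        vertex P i ~ vertex Q j' → vertex P i' ~ vertex Q j →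
        crosses (vertex P 0) (vertex Q m) (vertex Q 0) (vertex P k) ≡ false
      crossed-rungs-keep-ends-apart {i} {i'} {j} {j'} i<i' i'<k j<j' j'<m rung rung' =
        disjoint-walks-do-not-cross {A} {B} A∩B=∅ (inj₁ (in-segment P z≤n z≤n)) (inj₂ (in-segment Q j'≤m ≤-refl))
          (segment-walk P (λ 0≤t t≤i → inj₁ (in-segment P 0≤t t≤i)) (≤⇒≤′ z≤n) i<k
            ◅◅ ((inj₁ (in-segment P z≤n ≤-refl) , inj₂ (in-segment Q ≤-refl j'≤m) , rung)
            ◅ segment-walk Q (λ j'≤t t≤m → inj₂ (in-segment Q j'≤t t≤m)) (≤⇒≤′ j'≤m) ≤-refl))
          (segment-walk Q (λ 0≤t t≤j → inj₁ (in-segment Q 0≤t t≤j)) (≤⇒≤′ z≤n) j<m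
            ◅◅ ((inj₁ (in-segment Q z≤n ≤-refl) , inj₂ (in-segment P ≤-refl i'≤k) , E-sym G rung')
            ◅ segment-walk P (λ i'≤t t≤k → inj₂ (in-segment P i'≤t t≤k)) (≤⇒≤′ i'≤k) ≤-refl))
        where
        i<k : i < suc k
        i<k = <-trans i<i' i'<k
        j<m : j < suc m
        j<m = <-trans j<j' j'<m
        i'≤k : i' ≤ k
        i'≤k = s≤s⁻¹ i'<k
        j'≤m : j' ≤ m
        j'≤m = s≤s⁻¹ j'<m
        A B : V → Set
        A v = Segment P 0 i v ⊎ Segment Q j' m v
        B v = Segment Q 0 j v ⊎ Segment P i' k v
        A∩B=∅ : ∀ {v} → A v → ¬ B v
        A∩B=∅ (inj₁ P-early) (inj₁ Q-early) = disjoint-segments-apart P Q P∩Q=∅ i<k j<m P-early Q-early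
        A∩B=∅ (inj₁ P-early) (inj₂ P-late)  = segments-apart P i<i' ≤-refl P-early P-late
        A∩B=∅ (inj₂ Q-late)  (inj₁ Q-early) = segments-apart Q j<j' ≤-refl Q-early Q-late
        A∩B=∅ (inj₂ Q-late)  (inj₂ P-late)  = disjoint-segments-apart P Q P∩Q=∅ ≤-refl ≤-refl P-late Q-late

      crossing-ends⇒parallel : crosses (vertex P 0) (vertex Q m) (vertex Q 0) (vertex P k) ≡ true → Parallel P Q
      crossing-ends⇒parallel crossing i<i' i'<k j<j' j'<m rung rung' =
        contradiction (trans (sym crossing) (crossed-rungs-keep-ends-apart i<i' i'<k j<j' j'<m rung rung')) λ ()

    parallel-in-some-orientation : ∀ {k m} (P : IndexedPath (suc k)) (Q : IndexedPath (suc m)) →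
                                   Disjoint P Q → Parallel P Q ⊎ Parallel P (reverse Q)
    parallel-in-some-orientation {m = zero} _ _ _ = inj₁ λ _ _ j<j' j'<1 _ _ → n≮0 (<-≤-trans j<j' (s≤s⁻¹ j'<1))
    parallel-in-some-orientation {k} {suc m} P Q P∩Q=∅
      with one-of-last-two (some-matching-crosses {vertex P 0} pk≢q0 pk≢qm q0≢qm) (ends-do-not-cross P Q P∩Q=∅)
      where
      pk≢q0 : vertex P k ≢ vertex Q 0
      pk≢q0 = P∩Q=∅ ≤-refl z<s
      pk≢qm : vertex P k ≢ vertex Q (suc m)
      pk≢qm = P∩Q=∅ ≤-refl ≤-refl
      q0≢qm : vertex Q 0 ≢ vertex Q (suc m)
      q0≢qm = 0≢1+n ∘ injective Q z<s ≤-refl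
    ... | inj₁ q0-first = inj₂ (crossing-ends⇒parallel P (reverse Q) (reverse-disjoint P Q P∩Q=∅)
      (subst (λ q → crosses (vertex P 0) q (vertex Q (suc m)) (vertex P k) ≡ true) (sym (reverse-last Q)) q0-first))
    ... | inj₂ qm-first = inj₁ (crossing-ends⇒parallel P Q P∩Q=∅ qm-first)

  two-path-cover⇒Z≡2 : IsOuterplanar G → ¬ IsPath G → ∀ {k m} (P : IndexedPath (suc k)) (Q : IndexedPath (suc m)) →
                       Disjoint P Q → Covering P Q → ZeroForcingNumber≡ G 2
  two-path-cover⇒Z≡2 outerplanar not-path P Q P∩Q=∅ cover =
    upper (Chords.parallel-in-some-orientation outerplanar P Q P∩Q=∅) , non-path⇒Z≥2 not-path (vertex P 0)
    where
    upper : Parallel P Q ⊎ Parallel P (reverse Q) → ∃[ S ] IsZeroForcingSet G S × ∣ S ∣ ≡ 2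
    upper (inj₁ parallel) =
      _ , parallel-paths-forced-from-starts P Q cover parallel , ∣⁅x⁆∪⁅y⁆∣≡2 (P∩Q=∅ z<s z<s)
    upper (inj₂ parallel) =
      _ , parallel-paths-forced-from-starts P (reverse Q) (Sum.map₂ (reverse-onPath Q) ∘ cover) parallel ,
      ∣⁅x⁆∪⁅y⁆∣≡2 (reverse-disjoint P Q P∩Q=∅ z<s z<s)

  two-list-cover⇒Z≡2 : IsOuterplanar G → ¬ IsPath G → ∀ {p q ps qs} →
    IsInducedPath G (p ∷ ps) → IsInducedPath G (q ∷ qs) → Unique ((p ∷ ps) ++ (q ∷ qs)) →
    (∀ v → v ∈ₗ (p ∷ ps) ++ (q ∷ qs)) → ZeroForcingNumber≡ G 2
  two-list-cover⇒Z≡2 outerplanar not-path {p} {q} {ps} {qs} P-induced Q-induced unique covers =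
    two-path-cover⇒Z≡2 outerplanar not-path P Q
      (λ i< j< eq → ++-unique⇒disjoint unique (nth-∈ p (p ∷ ps) i<)
                                              (subst (_∈ₗ q ∷ qs) (sym eq) (nth-∈ q (q ∷ qs) j<)))
      (Sum.map (∈⇒OnPath p P-induced) (∈⇒OnPath q Q-induced) ∘ ∈-++⁻ (p ∷ ps) ∘ covers)
    where
    P : IndexedPath (suc (length ps))
    P = fromInducedList p P-induced
    Q : IndexedPath (suc (length qs))
    Q = fromInducedList q Q-induced

theorem4p1 : ∀ (n : ℕ) (G : Graph n) → IsDoublePath G → ZeroForcingNumber≡ G 2
theorem4p1 n G (_ , not-path , [] , Q , _ , Q-induced , _ , covers) = ⊥-elim (not-path (Q , Q-induced , covers))
theorem4p1 n G (_ , not-path , P@(_ ∷ _) , [] , P-induced , _ , _ , covers) =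
  ⊥-elim (not-path (P , P-induced , λ v → subst (v ∈ₗ_) (++-identityʳ P) (covers v)))
theorem4p1 n G (outerplanar , not-path , _ ∷ _ , _ ∷ _ , P-induced , Q-induced , unique , covers) =
  two-list-cover⇒Z≡2 G outerplanar not-path P-induced Q-induced unique covers
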